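{- Let $G$ be a finite group (written additively) and let $\mathcal X$ be a Hadamard $(G,K,\lambda)$-PDF, i.e. a $(G,K,\lambda)$-PDF with $|G|=2\lambda$. Then $\{{}^2X \mid X\in\mathcal X\}$ is a $(G,2K,4\lambda)$ strong difference family, where $2K$ is the multiset $\{2k: k\in K\}$.
   Context: For a multiset $X=\{x_1,\dots,x_k\}$ on an additive group $G$, $\Delta X$ is the multiset of all $x_i-x_j$ with $(i,j)$ an ordered pair of distinct indices (so repeated elements of $X$ contribute the difference $0$); for a collection $\mathcal X$ of multisets, $\Delta\mathcal X$ is the multiset sum of the $\Delta X$. For a multiset $X$, ${}^\mu X$ denotes the multiset sum of $\mu$ copies of $X$. A $(G,K,\lambda)$-PDF is a collection of subsets of $G$ partitioning $G$, with multiset of block sizes $K$, such that $\Delta\mathcal X$ contains every nonzero element of $G$ exactly $\lambda$ times and $0$ never. A $(G,K,\mu)$ strong difference family (SDF) is a collection $\mathcal X$ of multisubsets of $G$ with multiset of sizes $K$ such that $\Delta\mathcal X={}^\mu G$, i.e. every element of $G$, including $0$, occurs exactly $\mu$ times in $\Delta\mathcal X$. -}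

module Defs where

open import Level using (Level)
open import Algebra.Bundles using (Group)
open import Data.Nat using (ℕ; _*_)
open import Data.List using (List; []; _∷_; _++_; map; concat; length; filter)
open import Data.List.Relation.Unary.All using (All)
open import Data.List.Relation.Binary.Permutation.Propositional using (_↭_)
open import Relation.Binary.Core using (Rel)
open import Relation.Binary.Definitions using (Decidable)
open import Relation.Binary.PropositionalEquality using (_≡_; _≢_)
open import Relation.Nullary using (¬_)

-- A finite group (written additively) is a group 𝒢 together with a decision
-- procedure for its equality and a list enumerating every element exactly once.
module FiniteGroupTheory {c ℓ : Level} (𝒢 : Group c ℓ)
                         (_≟_ : Decidable (Group._≈_ 𝒢)) where
  open Group 𝒢 renaming (Carrier to G; _∙_ to _+_; ε to 0#; _⁻¹ to -_)

  -- Multisets on G are lists; multiplicity of g in a multiset.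
  count : G → List G → ℕ
  count g xs = length (filter (λ y → y ≟ g) xs)

  _−_ : G → G → G
  x − y = x + (- y)

  -- ΔX : all x_i - x_j over ordered pairs (i,j) of distinct positions of X.
  Δ : List G → List G
  Δ []       = []
  Δ (x ∷ xs) = map (x −_) xs ++ map (_− x) xs ++ Δ xs

  Δ𝒳 : List (List G) → List G
  Δ𝒳 𝒳 = concat (map Δ 𝒳)

  -- ^μ X : multiset sum of μ copies of X.
  copies : ℕ → List G → List G
  copies Data.Nat.zero    X = []
  copies (Data.Nat.suc μ) X = X ++ copies μ X

  IsEnumeration : List G → Set c
  IsEnumeration elems = ∀ g → count g elems ≡ 1

  -- 𝒳 partitions G: blocks are nonempty, and every element of G lies in
  -- exactly one block, exactly once (so blocks are sets, pairwise disjoint, covering G).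
  IsPartition : List (List G) → Set c
  IsPartition 𝒳 = All (λ X → X ≢ []) 𝒳 × (∀ g → count g (concat 𝒳) ≡ 1)
    where open import Data.Product using (_×_)

  record IsPDF (K : List ℕ) (λ' : ℕ) (𝒳 : List (List G)) : Set (c Level.⊔ ℓ) where
    field
      partition : IsPartition 𝒳
      sizes     : map length 𝒳 ↭ K
      nonzero   : ∀ g → ¬ (g ≈ 0#) → count g (Δ𝒳 𝒳) ≡ λ'
      zero      : count 0# (Δ𝒳 𝒳) ≡ 0

  record IsHadamardPDF (elems : List G) (K : List ℕ) (λ' : ℕ) (𝒳 : List (List G)) : Set (c Level.⊔ ℓ) where
    field
      pdf      : IsPDF K λ' 𝒳
      hadamard : length elems ≡ 2 * λ'

  -- (G,K,μ) strong difference family: Δ𝒳 = ^μ G, i.e. every g occurs μ times.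
  record IsSDF (K : List ℕ) (μ : ℕ) (𝒳 : List (List G)) : Set (c Level.⊔ ℓ) where
    field
      sizes : map length 𝒳 ↭ K
      diffs : ∀ g → count g (Δ𝒳 𝒳) ≡ μ

module Submission where

-- Everything is computed with multiplicities: for g ∈ G write #xs for the
-- number of occurrences of g in the list xs.  Writing X ⊖ Y for the list of
-- all x − y (x ∈ X, y ∈ Y), splitting a list gives
--     Δ(X ++ Y) = ΔX + ΔY + (X ⊖ Y) + (Y ⊖ X),      X ⊖ X = ΔX + {x − x | x ∈ X},
-- hence  #Δ(²X) = 4·#ΔX + 2·#{x − x | x ∈ X}, and summing over the blocks
--     #Δ𝒳(²𝒳) = 4·#Δ𝒳(𝒳) + 2·#{x − x | x ∈ ⋃𝒳}.
-- For g ≢ 0 the second term vanishes and the PDF gives 4λ.  For g = 0 the PDF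
-- gives #Δ𝒳(𝒳) = 0 and the second term is 2·|⋃𝒳|; since ⋃𝒳 and the
-- enumeration of G both contain every element exactly once, a double-counting
-- argument shows |⋃𝒳| = |G| = 2λ, so again the total is 4λ.

open import Defs
open import Level using (Level)
open import Algebra.Bundles using (Group)
open import Data.Nat using (ℕ; _*_; _+_)
open import Data.Nat.Properties using (+-identityʳ; *-assoc)
open import Data.Nat.Tactic.RingSolver using (solve-∀)
open import Data.List using (List; []; _∷_; _++_; [_]; map; concat; length; filter)
open import Data.Nat.ListAction using (sum)
open import Data.List.Properties
  using (map-++; length-++; length-map; ++-identityʳ; filter-++; filter-≐; filter-all; filter-none)
open import Data.List.Relation.Unary.All using (universal)
import Data.List.Relation.Unary.All.Properties as All
open import Data.List.Relation.Binary.Permutation.Propositional using (_↭_)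
import Data.List.Relation.Binary.Permutation.Propositional.Properties as Perm
open import Data.Product using (_,_; proj₂)
open import Relation.Binary.Definitions using (Decidable)
open import Relation.Binary.PropositionalEquality
  using (_≡_; refl; sym; trans; cong; cong₂; subst; module ≡-Reasoning)
open import Relation.Nullary using (¬_; yes; no)
open import Data.Empty using (⊥-elim)

module Multisets {c ℓ : Level} (𝒢 : Group c ℓ) (_≟_ : Decidable (Group._≈_ 𝒢)) where
  open FiniteGroupTheory 𝒢 _≟_
  open Group 𝒢 using (_≈_; inverseʳ) renaming (Carrier to G; ε to 0#)
  open ≡-Reasoning

  count-++ : ∀ g xs ys → count g (xs ++ ys) ≡ count g xs + count g ys
  count-++ g xs ys =
    trans (cong length (filter-++ (λ y → y ≟ g) xs ys)) (length-++ (filter (λ y → y ≟ g) xs))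

  count-resp-≈ : ∀ {g h} → g ≈ h → ∀ xs → count g xs ≡ count h xs
  count-resp-≈ g≈h xs =
    cong length (filter-≐ (λ y → y ≟ _) (λ y → y ≟ _)
                  ((λ y≈g → Group.trans 𝒢 y≈g g≈h) , (λ y≈h → Group.trans 𝒢 y≈h (Group.sym 𝒢 g≈h))) xs)

  selfDiffs : List G → List G
  selfDiffs = map (λ x → x − x)

  count-selfDiffs-nonzero : ∀ {g} → ¬ (g ≈ 0#) → ∀ xs → count g (selfDiffs xs) ≡ 0
  count-selfDiffs-nonzero g≉0 xs =
    cong length (filter-none (λ y → y ≟ _)
      (All.map⁺ (universal (λ x x−x≈g → g≉0 (Group.trans 𝒢 (Group.sym 𝒢 x−x≈g) (inverseʳ x))) xs)))

  count-selfDiffs-zero : ∀ xs → count 0# (selfDiffs xs) ≡ length xs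
  count-selfDiffs-zero xs = begin
    length (filter (λ y → y ≟ 0#) (selfDiffs xs))
      ≡⟨ cong length (filter-all (λ y → y ≟ 0#) (All.map⁺ (universal inverseʳ xs))) ⟩
    length (selfDiffs xs)
      ≡⟨ length-map (λ x → x − x) xs ⟩
    length xs ∎

  sizes-copies2 : ∀ 𝒳 → map length (map (copies 2) 𝒳) ≡ map (2 *_) (map length 𝒳)
  sizes-copies2 []      = refl
  sizes-copies2 (X ∷ 𝒳) = cong₂ _∷_ (trans (length-++ X) (cong (length X +_) (length-++ X))) (sizes-copies2 𝒳)

  -- Double counting: matches xs ys is the number of pairs of positions
  -- (i , j) with xs i ≈ ys j; it is symmetric in its two arguments.
  matches : List G → List G → ℕ
  matches xs ys = sum (map (λ x → count x ys) xs)

  count-singleton-sym : ∀ x y → count x [ y ] ≡ count y [ x ]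
  count-singleton-sym x y with y ≟ x | x ≟ y
  ... | yes _   | yes _   = refl
  ... | no _    | no _    = refl
  ... | yes y≈x | no x≉y  = ⊥-elim (x≉y (Group.sym 𝒢 y≈x))
  ... | no y≉x  | yes x≈y = ⊥-elim (y≉x (Group.sym 𝒢 x≈y))

  matches-[]ʳ : ∀ xs → matches xs [] ≡ 0
  matches-[]ʳ []       = refl
  matches-[]ʳ (_ ∷ xs) = matches-[]ʳ xs

  matches-∷ʳ : ∀ xs y ys → matches xs (y ∷ ys) ≡ count y xs + matches xs ys
  matches-∷ʳ []       y ys = refl
  matches-∷ʳ (x ∷ xs) y ys = begin
    count x ([ y ] ++ ys) + matches xs (y ∷ ys)
      ≡⟨ cong₂ _+_ (count-++ x [ y ] ys) (matches-∷ʳ xs y ys) ⟩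
    (count x [ y ] + count x ys) + (count y xs + matches xs ys)
      ≡⟨ cong (λ e → (e + count x ys) + (count y xs + matches xs ys)) (count-singleton-sym x y) ⟩
    (count y [ x ] + count x ys) + (count y xs + matches xs ys)
      ≡⟨ interchange (count y [ x ]) (count x ys) (count y xs) (matches xs ys) ⟩
    (count y [ x ] + count y xs) + (count x ys + matches xs ys)
      ≡⟨ cong (_+ matches (x ∷ xs) ys) (sym (count-++ y [ x ] xs)) ⟩
    count y (x ∷ xs) + matches (x ∷ xs) ys ∎
    where
    interchange : ∀ a b c d → (a + b) + (c + d) ≡ (a + c) + (b + d)
    interchange = solve-∀

  matches-comm : ∀ xs ys → matches xs ys ≡ matches ys xs
  matches-comm xs []       = matches-[]ʳ xs
  matches-comm xs (y ∷ ys) = trans (matches-∷ʳ xs y ys) (cong (count y xs +_) (matches-comm xs ys))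

  matches-enumeration : ∀ xs ys → IsEnumeration ys → matches xs ys ≡ length xs
  matches-enumeration []       ys enum = refl
  matches-enumeration (x ∷ xs) ys enum = cong₂ _+_ (enum x) (matches-enumeration xs ys enum)

  enumerations-length : ∀ xs ys → IsEnumeration xs → IsEnumeration ys → length xs ≡ length ys
  enumerations-length xs ys enumX enumY = begin
    length xs      ≡⟨ sym (matches-enumeration xs ys enumY) ⟩
    matches xs ys  ≡⟨ matches-comm xs ys ⟩
    matches ys xs  ≡⟨ matches-enumeration ys xs enumX ⟩
    length ys      ∎

module Differences {c ℓ : Level} (𝒢 : Group c ℓ) (_≟_ : Decidable (Group._≈_ 𝒢)) (g : Group.Carrier 𝒢) where
  open FiniteGroupTheory 𝒢 _≟_
  open Multisets 𝒢 _≟_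
  open Group 𝒢 using () renaming (Carrier to G)
  open ≡-Reasoning

  #_ : List G → ℕ
  # xs = count g xs

  infix 10 #_

  #-++ : ∀ xs ys → # (xs ++ ys) ≡ # xs + # ys
  #-++ = count-++ g

  _⊖_ : List G → List G → List G
  []       ⊖ ys = []
  (x ∷ xs) ⊖ ys = map (x −_) ys ++ (xs ⊖ ys)

  ⊖-[]ʳ : ∀ xs → # (xs ⊖ []) ≡ 0
  ⊖-[]ʳ []       = refl
  ⊖-[]ʳ (_ ∷ xs) = ⊖-[]ʳ xs

  ⊖-∷ʳ : ∀ xs y ys → # (xs ⊖ (y ∷ ys)) ≡ # (map (_− y) xs) + # (xs ⊖ ys)
  ⊖-∷ʳ []       y ys = refl
  ⊖-∷ʳ (x ∷ xs) y ys = begin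
    # ((x − y ∷ map (x −_) ys) ++ (xs ⊖ (y ∷ ys)))
      ≡⟨ #-++ (x − y ∷ map (x −_) ys) _ ⟩
    # ([ x − y ] ++ map (x −_) ys) + # (xs ⊖ (y ∷ ys))
      ≡⟨ cong₂ _+_ (#-++ [ x − y ] _) (⊖-∷ʳ xs y ys) ⟩
    (# [ x − y ] + # map (x −_) ys) + (# map (_− y) xs + # (xs ⊖ ys))
      ≡⟨ interchange (# [ x − y ]) (# map (x −_) ys) (# map (_− y) xs) (# (xs ⊖ ys)) ⟩
    (# [ x − y ] + # map (_− y) xs) + (# map (x −_) ys + # (xs ⊖ ys))
      ≡⟨ sym (cong₂ _+_ (#-++ [ x − y ] _) (#-++ (map (x −_) ys) _)) ⟩
    # map (_− y) (x ∷ xs) + # ((x ∷ xs) ⊖ ys) ∎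
    where
    interchange : ∀ a b c d → (a + b) + (c + d) ≡ (a + c) + (b + d)
    interchange = solve-∀

  Δ-++ : ∀ xs ys → # Δ (xs ++ ys) ≡ # Δ xs + # Δ ys + # (xs ⊖ ys) + # (ys ⊖ xs)
  Δ-++ [] ys = begin
    # Δ ys                          ≡⟨ sym (+-identityʳ _) ⟩
    # Δ ys + 0                      ≡⟨ sym (+-identityʳ _) ⟩
    # Δ ys + 0 + 0                  ≡⟨ cong (# Δ ys + 0 +_) (sym (⊖-[]ʳ ys)) ⟩
    # Δ ys + 0 + # (ys ⊖ [])        ∎
  Δ-++ (x ∷ xs) ys = begin
    # (map (x −_) (xs ++ ys) ++ map (_− x) (xs ++ ys) ++ Δ (xs ++ ys))
      ≡⟨ #-++ (map (x −_) (xs ++ ys)) _ ⟩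
    # map (x −_) (xs ++ ys) + # (map (_− x) (xs ++ ys) ++ Δ (xs ++ ys))
      ≡⟨ cong (# map (x −_) (xs ++ ys) +_) (#-++ (map (_− x) (xs ++ ys)) _) ⟩
    # map (x −_) (xs ++ ys) + (# map (_− x) (xs ++ ys) + # Δ (xs ++ ys))
      ≡⟨ cong₂ (λ a b → a + (b + # Δ (xs ++ ys))) (#-map-++ (x −_) xs ys) (#-map-++ (_− x) xs ys) ⟩
    (l xs + l ys) + ((r xs + r ys) + # Δ (xs ++ ys))
      ≡⟨ cong (λ d → (l xs + l ys) + ((r xs + r ys) + d)) (Δ-++ xs ys) ⟩
    (l xs + l ys) + ((r xs + r ys) + (# Δ xs + # Δ ys + # (xs ⊖ ys) + # (ys ⊖ xs)))
      ≡⟨ regroup (l xs) (l ys) (r xs) (r ys) (# Δ xs) (# Δ ys) (# (xs ⊖ ys)) (# (ys ⊖ xs)) ⟩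
    (l xs + (r xs + # Δ xs)) + # Δ ys + (l ys + # (xs ⊖ ys)) + (r ys + # (ys ⊖ xs))
      ≡⟨ sym (cong₂ (λ a b → a + # Δ ys + b + (r ys + # (ys ⊖ xs)))
                    (trans (#-++ (map (x −_) xs) _) (cong (l xs +_) (#-++ (map (_− x) xs) (Δ xs))))
                    (#-++ (map (x −_) ys) (xs ⊖ ys))) ⟩
    # Δ (x ∷ xs) + # Δ ys + # ((x ∷ xs) ⊖ ys) + (r ys + # (ys ⊖ xs))
      ≡⟨ cong (# Δ (x ∷ xs) + # Δ ys + # ((x ∷ xs) ⊖ ys) +_) (sym (⊖-∷ʳ ys x xs)) ⟩
    # Δ (x ∷ xs) + # Δ ys + # ((x ∷ xs) ⊖ ys) + # (ys ⊖ (x ∷ xs)) ∎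
    where
    l r : List G → ℕ
    l zs = # map (x −_) zs
    r zs = # map (_− x) zs

    #-map-++ : ∀ f us vs → # map f (us ++ vs) ≡ # map f us + # map f vs
    #-map-++ f us vs = trans (cong #_ (map-++ f us vs)) (#-++ (map f us) (map f vs))

    regroup : ∀ a₁ a₂ b₁ b₂ d₁ d₂ c₁ c₂ →
              (a₁ + a₂) + ((b₁ + b₂) + (d₁ + d₂ + c₁ + c₂))
              ≡ (a₁ + (b₁ + d₁)) + d₂ + (a₂ + c₁) + (b₂ + c₂)
    regroup = solve-∀

  ⊖-self : ∀ xs → # (xs ⊖ xs) ≡ # Δ xs + # selfDiffs xs
  ⊖-self []       = refl
  ⊖-self (x ∷ xs) = begin
    # ((x − x ∷ map (x −_) xs) ++ (xs ⊖ (x ∷ xs)))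
      ≡⟨ #-++ (x − x ∷ map (x −_) xs) _ ⟩
    # ([ x − x ] ++ map (x −_) xs) + # (xs ⊖ (x ∷ xs))
      ≡⟨ cong₂ _+_ (#-++ [ x − x ] _) (trans (⊖-∷ʳ xs x xs) (cong (# map (_− x) xs +_) (⊖-self xs))) ⟩
    (e + # map (x −_) xs) + (# map (_− x) xs + (# Δ xs + # selfDiffs xs))
      ≡⟨ regroup e (# map (x −_) xs) (# map (_− x) xs) (# Δ xs) (# selfDiffs xs) ⟩
    (# map (x −_) xs + (# map (_− x) xs + # Δ xs)) + (e + # selfDiffs xs)
      ≡⟨ sym (cong₂ _+_ (trans (#-++ (map (x −_) xs) _) (cong (# map (x −_) xs +_) (#-++ (map (_− x) xs) (Δ xs))))
                         (#-++ [ x − x ] (selfDiffs xs))) ⟩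
    # Δ (x ∷ xs) + # selfDiffs (x ∷ xs) ∎
    where
    e : ℕ
    e = # [ x − x ]

    regroup : ∀ e a b d s → (e + a) + (b + (d + s)) ≡ (a + (b + d)) + (e + s)
    regroup = solve-∀

  Δ-copies2 : ∀ xs → # Δ (copies 2 xs) ≡ 4 * # Δ xs + 2 * # selfDiffs xs
  Δ-copies2 xs = begin
    # Δ (xs ++ (xs ++ []))
      ≡⟨ cong (λ ys → # Δ (xs ++ ys)) (++-identityʳ xs) ⟩
    # Δ (xs ++ xs)
      ≡⟨ Δ-++ xs xs ⟩
    # Δ xs + # Δ xs + # (xs ⊖ xs) + # (xs ⊖ xs)
      ≡⟨ cong (λ t → # Δ xs + # Δ xs + t + t) (⊖-self xs) ⟩
    # Δ xs + # Δ xs + (# Δ xs + # selfDiffs xs) + (# Δ xs + # selfDiffs xs)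
      ≡⟨ collect (# Δ xs) (# selfDiffs xs) ⟩
    4 * # Δ xs + 2 * # selfDiffs xs ∎
    where
    collect : ∀ d s → d + d + (d + s) + (d + s) ≡ 4 * d + 2 * s
    collect = solve-∀

  Δ𝒳-copies2 : ∀ 𝒳 → # Δ𝒳 (map (copies 2) 𝒳) ≡ 4 * # Δ𝒳 𝒳 + 2 * # selfDiffs (concat 𝒳)
  Δ𝒳-copies2 []      = refl
  Δ𝒳-copies2 (X ∷ 𝒳) = begin
    # (Δ (copies 2 X) ++ Δ𝒳 (map (copies 2) 𝒳))
      ≡⟨ #-++ (Δ (copies 2 X)) _ ⟩
    # Δ (copies 2 X) + # Δ𝒳 (map (copies 2) 𝒳)
      ≡⟨ cong₂ _+_ (Δ-copies2 X) (Δ𝒳-copies2 𝒳) ⟩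
    (4 * # Δ X + 2 * # selfDiffs X) + (4 * # Δ𝒳 𝒳 + 2 * # selfDiffs (concat 𝒳))
      ≡⟨ distrib (# Δ X) (# selfDiffs X) (# Δ𝒳 𝒳) (# selfDiffs (concat 𝒳)) ⟩
    4 * (# Δ X + # Δ𝒳 𝒳) + 2 * (# selfDiffs X + # selfDiffs (concat 𝒳))
      ≡⟨ sym (cong₂ (λ d s → 4 * d + 2 * s) (#-++ (Δ X) (Δ𝒳 𝒳))
                    (trans (cong #_ (map-++ (λ x → x − x) X (concat 𝒳))) (#-++ (selfDiffs X) _))) ⟩
    4 * # Δ𝒳 (X ∷ 𝒳) + 2 * # selfDiffs (concat (X ∷ 𝒳)) ∎
    where
    distrib : ∀ d s d′ s′ → (4 * d + 2 * s) + (4 * d′ + 2 * s′) ≡ 4 * (d + d′) + 2 * (s + s′)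
    distrib = solve-∀

module DoubledPDF {c ℓ : Level} (𝒢 : Group c ℓ) (_≟_ : Decidable (Group._≈_ 𝒢)) where
  open FiniteGroupTheory 𝒢 _≟_
  open Multisets 𝒢 _≟_
  open Differences 𝒢 _≟_ using (Δ𝒳-copies2)
  open Group 𝒢 using (_≈_) renaming (ε to 0#)
  open ≡-Reasoning

  doubled-nonzero : ∀ {K λ' 𝒳} → IsPDF K λ' 𝒳 → ∀ g → ¬ (g ≈ 0#)
                  → count g (Δ𝒳 (map (copies 2) 𝒳)) ≡ 4 * λ'
  doubled-nonzero {λ' = λ'} {𝒳} pdf g g≉0 = begin
    count g (Δ𝒳 (map (copies 2) 𝒳))
      ≡⟨ Δ𝒳-copies2 g 𝒳 ⟩
    4 * count g (Δ𝒳 𝒳) + 2 * count g (selfDiffs (concat 𝒳))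
      ≡⟨ cong₂ (λ d s → 4 * d + 2 * s) (IsPDF.nonzero pdf g g≉0) (count-selfDiffs-nonzero g≉0 (concat 𝒳)) ⟩
    4 * λ' + 0
      ≡⟨ +-identityʳ (4 * λ') ⟩
    4 * λ' ∎

  doubled-zero : ∀ {K λ' 𝒳} → IsPDF K λ' 𝒳
               → count 0# (Δ𝒳 (map (copies 2) 𝒳)) ≡ 2 * length (concat 𝒳)
  doubled-zero {𝒳 = 𝒳} pdf = begin
    count 0# (Δ𝒳 (map (copies 2) 𝒳))
      ≡⟨ Δ𝒳-copies2 0# 𝒳 ⟩
    4 * count 0# (Δ𝒳 𝒳) + 2 * count 0# (selfDiffs (concat 𝒳))
      ≡⟨ cong₂ (λ d s → 4 * d + 2 * s) (IsPDF.zero pdf) (count-selfDiffs-zero (concat 𝒳)) ⟩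
    2 * length (concat 𝒳) ∎

  doubled-sizes : ∀ {K λ' 𝒳} → IsPDF K λ' 𝒳 → map length (map (copies 2) 𝒳) ↭ map (2 *_) K
  doubled-sizes {K} {𝒳 = 𝒳} pdf =
    subst (_↭ map (2 *_) K) (sym (sizes-copies2 𝒳)) (Perm.map⁺ (2 *_) (IsPDF.sizes pdf))

proposition2p2 : {c ℓ : Level} (𝒢 : Group c ℓ) (_≟_ : Decidable (Group._≈_ 𝒢))
    → let open FiniteGroupTheory 𝒢 _≟_ in
      (elems : List (Group.Carrier 𝒢)) → IsEnumeration elems
    → (K : List ℕ) (λ' : ℕ) (𝒳 : List (List (Group.Carrier 𝒢)))
    → IsHadamardPDF elems K λ' 𝒳
    → IsSDF (map (2 *_) K) (4 * λ') (map (copies 2) 𝒳)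
proposition2p2 𝒢 _≟_ elems enum K λ' 𝒳 hadamardPDF =
  record { sizes = doubled-sizes pdf ; diffs = doubledDiffs }
  where
  open FiniteGroupTheory 𝒢 _≟_
  open Multisets 𝒢 _≟_ using (count-resp-≈; enumerations-length)
  open DoubledPDF 𝒢 _≟_
  open Group 𝒢 using () renaming (ε to 0#)
  open IsHadamardPDF hadamardPDF

  unionSize : length (concat 𝒳) ≡ 2 * λ'
  unionSize = trans (enumerations-length (concat 𝒳) elems (proj₂ (IsPDF.partition pdf)) enum) hadamard

  doubledDiffs : ∀ g → count g (Δ𝒳 (map (copies 2) 𝒳)) ≡ 4 * λ'
  doubledDiffs g with g ≟ 0#
  ... | no g≉0  = doubled-nonzero pdf g g≉0
  ... | yes g≈0 = trans (count-resp-≈ g≈0 (Δ𝒳 (map (copies 2) 𝒳)))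
                  (trans (doubled-zero pdf) (trans (cong (2 *_) unionSize) (sym (*-assoc 2 2 λ'))))
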